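{- For any graphs $G$ and $H$ with no isolated vertex, $$\gamma_{R}(G\times H)\leq 2\gamma_t(G)\gamma_{t}(H)-2k(G)k(H).$$
   Context: All graphs are finite and simple. The direct product $G\times H$ has vertex set $V(G)\times V(H)$, with $(u,v)$ adjacent to $(u',v')$ iff $uu'\in E(G)$ and $vv'\in E(H)$. A set $S$ is dominating if every vertex is in $S$ or adjacent to a vertex of $S$. A set $D$ is total dominating if every vertex has a neighbor in $D$; $\gamma_t(G)$ is the minimum size of a total dominating set, and a total dominating set of this size is a $\gamma_t(G)$-set. For a $\gamma_t(G)$-set $D$, let $D'\subseteq D$ be a dominating set of $G$ of minimum cardinality among dominating sets of $G$ contained in $D$; the set $D\setminus D'$ is called a kernel of $D$. $k(G)$ denotes the maximum cardinality of $D\setminus D'$ over all $\gamma_t(G)$-sets $D$ and all such $D'$. A Roman dominating function on $G$ is $f:V(G)\to\{0,1,2\}$ such that every vertex with value $0$ has a neighbor with value $2$; $\gamma_R(G)$ is the minimum of $\sum_v f(v)$ over such $f$. -}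

module Defs where

open import Data.Nat using (ℕ; _+_; _*_; _∸_; _≤_)
open import Data.Bool using (Bool; T; _∧_)
open import Data.Fin using (Fin; toℕ; remQuot)
open import Data.Fin.Subset using (Subset; _∈_; _⊆_; ∣_∣)
open import Data.Vec using (tabulate)
open import Data.Nat.ListAction using (sum)
import Data.Vec as Vec
open import Data.Product using (Σ; ∃; ∃-syntax; _×_; _,_; proj₁; proj₂)
open import Data.Sum using (_⊎_)
open import Relation.Binary.PropositionalEquality using (_≡_)
open import Relation.Nullary using (¬_)

record Graph : Set where
  field
    n     : ℕ
    adj   : Fin n → Fin n → Bool
    sym   : ∀ u v → T (adj u v) → T (adj v u)
    irref : ∀ v → ¬ T (adj v v)

open Graph public

Adj : (G : Graph) → Fin (n G) → Fin (n G) → Set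
Adj G u v = T (adj G u v)

NoIsolated : Graph → Set
NoIsolated G = ∀ v → ∃[ u ] Adj G v u

fstV : (G H : Graph) → Fin (n G * n H) → Fin (n G)
fstV G H x = proj₁ (remQuot {n G} (n H) x)

sndV : (G H : Graph) → Fin (n G * n H) → Fin (n H)
sndV G H x = proj₂ (remQuot {n G} (n H) x)

prodAdj : (G H : Graph) → Fin (n G * n H) → Fin (n G * n H) → Bool
prodAdj G H x y =
  adj G (fstV G H x) (fstV G H y) ∧
  adj H (sndV G H x) (sndV G H y)


open import Data.Bool.Properties using (T-∧)
open import Function.Bundles using (Equivalence)

_×ᵍ_ : Graph → Graph → Graph
G ×ᵍ H = record
  { n = n G * n H
  ; adj = prodAdj G H
  ; sym = s
  ; irref = i
  }
  where
  open Equivalence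
  s : ∀ x y → T (prodAdj G H x y) → T (prodAdj G H y x)
  s x y p =
    let u = fstV G H x; v = sndV G H x
        u' = fstV G H y; v' = sndV G H y
        ab = to (T-∧ {adj G u u'}) p
    in from T-∧ (Graph.sym G u u' (proj₁ ab) , Graph.sym H v v' (proj₂ ab))
  i : ∀ x → ¬ T (prodAdj G H x x)
  i x p = let u = fstV G H x in
    irref G u (proj₁ (to (T-∧ {adj G u u}) p))

Dominating : (G : Graph) → Subset (n G) → Set
Dominating G S = ∀ v → v ∈ S ⊎ ∃[ u ] (u ∈ S × Adj G u v)

TotalDominating : (G : Graph) → Subset (n G) → Set
TotalDominating G S = ∀ v → ∃[ u ] (u ∈ S × Adj G v u)

IsTotalDomNumber : Graph → ℕ → Set
IsTotalDomNumber G t =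
  (∃[ D ] (TotalDominating G D × ∣ D ∣ ≡ t)) ×
  (∀ D → TotalDominating G D → t ≤ ∣ D ∣)

IsγtSet : (G : Graph) → Subset (n G) → Set
IsγtSet G D = TotalDominating G D × IsTotalDomNumber G ∣ D ∣

IsMinDomInside : (G : Graph) → Subset (n G) → Subset (n G) → Set
IsMinDomInside G D D' =
  D' ⊆ D × Dominating G D' ×
  (∀ D'' → D'' ⊆ D → Dominating G D'' → ∣ D' ∣ ≤ ∣ D'' ∣)

-- k is the size |D \ D'| of some kernel (D' ⊆ D, so |D \ D'| = |D| - |D'|)
IsKernelSize : Graph → ℕ → Set
IsKernelSize G k = ∃[ D ] ∃[ D' ]
  (IsγtSet G D × IsMinDomInside G D D' × k ≡ ∣ D ∣ ∸ ∣ D' ∣)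

IsKernelNumber : Graph → ℕ → Set
IsKernelNumber G k = IsKernelSize G k × (∀ k' → IsKernelSize G k' → k' ≤ k)

RomanDominating : (G : Graph) → (Fin (n G) → Fin 3) → Set
RomanDominating G f = ∀ v → toℕ (f v) ≡ 0 → ∃[ u ] (Adj G v u × toℕ (f u) ≡ 2)

weight : (G : Graph) → (Fin (n G) → Fin 3) → ℕ
weight G f = sum (Vec.toList (tabulate (λ v → toℕ (f v))))

IsRomanDomNumber : Graph → ℕ → Set
IsRomanDomNumber G r =
  (∃[ f ] (RomanDominating G f × weight G f ≡ r)) ×
  (∀ f → RomanDominating G f → r ≤ weight G f)

-- Let D be a γt(G)-set with a kernel D ∖ D′ (D′ ⊆ D dominating G) and
-- similarly E, E′ for H.  The set S = (D′ × E) ∪ ((D ∖ D′) × E′) dominates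
-- G × H: a vertex (u , v) with u ∉ D′ is reached from D′ × E, and one with
-- u ∈ D′, v ∉ E′ from D × E′, using that D and E are total dominating.
-- Hence 2·𝟙_S is a Roman dominating function of weight
-- 2 (|D′| |E| + |D ∖ D′| |E′|) = 2 (γt(G) γt(H) − |D ∖ D′| |E ∖ E′|).
module Submission where

open import Defs
open import Data.Nat using (ℕ; zero; suc; _+_; _*_; _∸_; _≤_; z≤n)
open import Data.Nat.Properties
  using (+-assoc; +-*-semiring; ≤-refl; ≤-antisym; ≤-trans; ≤-reflexive;
         m+n∸m≡n; m+n∸n≡m; m+[n∸m]≡n; module ≤-Reasoning)
import Data.Nat.ListAction as ListAction
open import Data.Nat.Tactic.RingSolver using (solve-∀)
open import Data.Bool using (Bool; true; false; T; _∧_; _∨_; not)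
open import Data.Bool.Properties using (T-∧)
open import Data.Fin using (Fin; toℕ; remQuot; quotRem; combine; splitAt)
import Data.Fin as Fin
open import Data.Fin.Patterns using (0F; 2F)
open import Data.Fin.Properties using (remQuot-combine)
open import Data.Fin.Subset using (Subset; _∈_; _∉_; _⊆_; ∣_∣)
open import Data.Fin.Subset.Properties using (_∈?_; p⊆q⇒∣p∣≤∣q∣)
open import Data.Vec using (_∷_; []; tabulate; lookup; toList)
open import Data.Vec.Properties
  using ([]=⇒lookup; lookup⇒[]=; lookup∘tabulate)
open import Data.Product using (∃-syntax; _×_; _,_; proj₁; proj₂; uncurry)
import Data.Product as Product
open import Data.Sum using (_⊎_; inj₁; inj₂; [_,_]′)
import Data.Sum as Sum
open import Function using (_∘_)
open import Function.Bundles using (Equivalence)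
open import Relation.Nullary using (yes; no; contradiction)
open import Relation.Binary.PropositionalEquality as ≡
  using (_≡_; refl; cong; cong₂; subst; module ≡-Reasoning)
open import Algebra.Properties.Semiring.Sum +-*-semiring
  using (sum; sum-syntax; sum-cong-≗; ∑-distrib-+; *-distribˡ-sum; *-distribʳ-sum)

sum-toList-tabulate : ∀ {n} (f : Fin n → ℕ) →
  ListAction.sum (toList (tabulate f)) ≡ ∑[ i < n ] f i
sum-toList-tabulate {zero}  f = refl
sum-toList-tabulate {suc n} f = cong (f 0F +_) (sum-toList-tabulate (f ∘ Fin.suc))

∑-linearˡ : ∀ {n} a b (x y : Fin n → ℕ) →
  ∑[ i < n ] (a * x i + b * y i) ≡ a * sum x + b * sum y
∑-linearˡ a b x y = ≡.trans (∑-distrib-+ (λ i → a * x i) (λ i → b * y i))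
  (cong₂ _+_ (≡.sym (*-distribˡ-sum a x)) (≡.sym (*-distribˡ-sum b y)))

∑-linearʳ : ∀ {n} a b (x y : Fin n → ℕ) →
  ∑[ i < n ] (x i * a + y i * b) ≡ sum x * a + sum y * b
∑-linearʳ a b x y = ≡.trans (∑-distrib-+ (λ i → x i * a) (λ i → y i * b))
  (cong₂ _+_ (≡.sym (*-distribʳ-sum a x)) (≡.sym (*-distribʳ-sum b y)))

∑-distrib-∸ : ∀ {n} (f g : Fin n → ℕ) → (∀ i → g i ≤ f i) →
  ∑[ i < n ] (f i ∸ g i) ≡ sum f ∸ sum g
∑-distrib-∸ f g g≤f = begin
  sum (λ i → f i ∸ g i)
    ≡⟨ m+n∸m≡n (sum g) _ ⟨
  sum g + sum (λ i → f i ∸ g i) ∸ sum g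
    ≡⟨ cong (_∸ sum g) (∑-distrib-+ g (λ i → f i ∸ g i)) ⟨
  sum (λ i → g i + (f i ∸ g i)) ∸ sum g
    ≡⟨ cong (_∸ sum g) (sum-cong-≗ (m+[n∸m]≡n ∘ g≤f)) ⟩
  sum f ∸ sum g
    ∎
  where open ≡-Reasoning

∑-splitAt : ∀ m {k} (h : Fin m ⊎ Fin k → ℕ) →
  ∑[ i < m + k ] h (splitAt m i) ≡ ∑[ i < m ] h (inj₁ i) + ∑[ j < k ] h (inj₂ j)
∑-splitAt zero    h = refl
∑-splitAt (suc m) h = ≡.trans
  (cong (h (inj₁ 0F) +_) (∑-splitAt m (h ∘ Sum.map₁ Fin.suc)))
  (≡.sym (+-assoc (h (inj₁ 0F)) _ _))

∑-remQuot : ∀ m n (g : Fin m → Fin n → ℕ) →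
  ∑[ x < m * n ] uncurry g (remQuot {m} n x) ≡ ∑[ u < m ] ∑[ v < n ] g u v
∑-remQuot zero    n g = refl
∑-remQuot (suc m) n g = ≡.trans (∑-splitAt n byBlock)
  (cong (∑[ v < n ] g 0F v +_) (∑-remQuot m n (g ∘ Fin.suc)))
  where
  -- remQuot {suc m} n unfolds to this function applied to splitAt n
  byBlock : Fin n ⊎ Fin (m * n) → ℕ
  byBlock = uncurry g ∘ Product.swap ∘ [ (_, 0F) , Product.map₂ Fin.suc ∘ quotRem {m} n ]′

indicator : Bool → ℕ
indicator true  = 1
indicator false = 0

indicator-mono : ∀ {x y} → (x ≡ true → y ≡ true) → indicator x ≤ indicator y
indicator-mono {false} x⇒y = z≤n
indicator-mono {true}  x⇒y rewrite x⇒y refl = ≤-refl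

∣p∣≡∑indicator : ∀ {n} (p : Subset n) → ∣ p ∣ ≡ ∑[ i < n ] indicator (lookup p i)
∣p∣≡∑indicator []          = refl
∣p∣≡∑indicator (true  ∷ p) = cong suc (∣p∣≡∑indicator p)
∣p∣≡∑indicator (false ∷ p) = ∣p∣≡∑indicator p

∣tabulate∣ : ∀ {n} (f : Fin n → Bool) → ∣ tabulate f ∣ ≡ ∑[ i < n ] indicator (f i)
∣tabulate∣ f = ≡.trans (∣p∣≡∑indicator (tabulate f))
  (sum-cong-≗ (cong indicator ∘ lookup∘tabulate f))

lookup-⊆ : ∀ {n} {p q : Subset n} {x} → p ⊆ q → lookup p x ≡ true → lookup q x ≡ true
lookup-⊆ {p = p} {x = x} p⊆q px = []=⇒lookup (p⊆q (lookup⇒[]= x p px))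

twoIf : Bool → Fin 3
twoIf true  = 2F
twoIf false = 0F

twoOn : ∀ {n} → Subset n → Fin n → Fin 3
twoOn S = twoIf ∘ lookup S

toℕ-twoOn-∈ : ∀ {n} {S : Subset n} {v} → v ∈ S → toℕ (twoOn S v) ≡ 2
toℕ-twoOn-∈ v∈S rewrite []=⇒lookup v∈S = refl

toℕ-twoIf : ∀ b → toℕ (twoIf b) ≡ 2 * indicator b
toℕ-twoIf true  = refl
toℕ-twoIf false = refl

dominating⇒romanDominating : ∀ (K : Graph) (S : Subset (n K)) →
  Dominating K S → RomanDominating K (twoOn S)
dominating⇒romanDominating K S dominating v f[v]≡0 with dominating v
... | inj₁ v∈S = contradiction (≡.trans (≡.sym (toℕ-twoOn-∈ v∈S)) f[v]≡0) λ ()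
... | inj₂ (u , u∈S , u~v) = u , sym K u v u~v , toℕ-twoOn-∈ u∈S

weight-twoOn : ∀ (K : Graph) (S : Subset (n K)) → weight K (twoOn S) ≡ 2 * ∣ S ∣
weight-twoOn K S = begin
  weight K (twoOn S)                         ≡⟨ sum-toList-tabulate (toℕ ∘ twoOn S) ⟩
  ∑[ v < n K ] toℕ (twoOn S v)               ≡⟨ sum-cong-≗ (toℕ-twoIf ∘ lookup S) ⟩
  ∑[ v < n K ] (2 * indicator (lookup S v))  ≡⟨ *-distribˡ-sum 2 (indicator ∘ lookup S) ⟨
  2 * ∑[ v < n K ] indicator (lookup S v)    ≡⟨ cong (2 *_) (∣p∣≡∑indicator S) ⟨
  2 * ∣ S ∣                                  ∎
  where open ≡-Reasoning

combine-adj : ∀ (G H : Graph) {w x z} →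
  Adj G x (fstV G H w) → Adj H z (sndV G H w) → Adj (G ×ᵍ H) (combine x z) w
combine-adj G H {w} {x} {z} x~u z~v =
  subst (λ (xz : Fin (n G) × Fin (n H)) →
           T (adj G (proj₁ xz) (fstV G H w) ∧ adj H (proj₂ xz) (sndV G H w)))
        (≡.sym (remQuot-combine x z))
        (Equivalence.from T-∧ (x~u , z~v))

module _ (G H : Graph) (D D′ : Subset (n G)) (E E′ : Subset (n H)) where

  inKernelProduct : Fin (n G) → Fin (n H) → Bool
  inKernelProduct u v =
    (lookup D′ u ∧ lookup E v) ∨ (lookup D u ∧ not (lookup D′ u) ∧ lookup E′ v)

  kernelProduct : Subset (n G * n H)
  kernelProduct = tabulate (λ w → inKernelProduct (fstV G H w) (sndV G H w))

  ∈-kernelProduct : ∀ {w} → inKernelProduct (fstV G H w) (sndV G H w) ≡ true → w ∈ kernelProduct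
  ∈-kernelProduct {w} w∈ = lookup⇒[]= w kernelProduct (≡.trans (lookup∘tabulate _ w) w∈)

  combine-∈-kernelProduct : ∀ {u v} → inKernelProduct u v ≡ true → combine u v ∈ kernelProduct
  combine-∈-kernelProduct {u} {v} uv∈ = ∈-kernelProduct (begin
    uncurry inKernelProduct (remQuot (n H) (combine u v))
      ≡⟨ cong (uncurry inKernelProduct) (remQuot-combine u v) ⟩
    inKernelProduct u v
      ≡⟨ uv∈ ⟩
    true
      ∎)
    where open ≡-Reasoning

  inKernelProduct-D′×E : ∀ {u v} → u ∈ D′ → v ∈ E → inKernelProduct u v ≡ true
  inKernelProduct-D′×E u∈D′ v∈E rewrite []=⇒lookup u∈D′ | []=⇒lookup v∈E = refl

  inKernelProduct-D×E′ : ∀ {u v} → u ∈ D → v ∈ E′ → v ∈ E → inKernelProduct u v ≡ true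
  inKernelProduct-D×E′ {u} u∈D v∈E′ v∈E
    rewrite []=⇒lookup u∈D | []=⇒lookup v∈E′ | []=⇒lookup v∈E with lookup D′ u
  ... | true  = refl
  ... | false = refl

  indicator-inKernelProduct : ∀ u v → indicator (inKernelProduct u v) ≡
    indicator (lookup D′ u) * indicator (lookup E v) +
    (indicator (lookup D u) ∸ indicator (lookup D′ u)) * indicator (lookup E′ v)
  indicator-inKernelProduct u v =
    lemma (lookup D′ u) (lookup E v) (lookup D u) (lookup E′ v)
    where
    lemma : ∀ x y z w → indicator ((x ∧ y) ∨ (z ∧ not x ∧ w)) ≡
      indicator x * indicator y + (indicator z ∸ indicator x) * indicator w
    lemma true  true  true  w     = refl
    lemma true  true  false w     = refl
    lemma true  false true  w     = refl
    lemma true  false false w     = refl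
    lemma false y     true  true  = refl
    lemma false y     true  false = refl
    lemma false y     false w     = refl

  ∣kernelProduct∣ : D′ ⊆ D → ∣ kernelProduct ∣ ≡ ∣ D′ ∣ * ∣ E ∣ + (∣ D ∣ ∸ ∣ D′ ∣) * ∣ E′ ∣
  ∣kernelProduct∣ D′⊆D = begin
    ∣ kernelProduct ∣
      ≡⟨ ∣tabulate∣ (uncurry inKernelProduct ∘ remQuot {n G} (n H)) ⟩
    ∑[ w < n G * n H ] indicator (uncurry inKernelProduct (remQuot {n G} (n H) w))
      ≡⟨ ∑-remQuot (n G) (n H) (λ u v → indicator (inKernelProduct u v)) ⟩
    ∑[ u < n G ] ∑[ v < n H ] indicator (inKernelProduct u v)
      ≡⟨ sum-cong-≗ row ⟩
    ∑[ u < n G ] (𝟙 D′ u * ∣ E ∣ + κ u * ∣ E′ ∣)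
      ≡⟨ ∑-linearʳ ∣ E ∣ ∣ E′ ∣ (𝟙 D′) κ ⟩
    sum (𝟙 D′) * ∣ E ∣ + sum κ * ∣ E′ ∣
      ≡⟨ cong₂ (λ d k → d * ∣ E ∣ + k * ∣ E′ ∣) (≡.sym (∣p∣≡∑indicator D′)) ∑κ ⟩
    ∣ D′ ∣ * ∣ E ∣ + (∣ D ∣ ∸ ∣ D′ ∣) * ∣ E′ ∣
      ∎
    where
    open ≡-Reasoning
    𝟙 : ∀ {m} → Subset m → Fin m → ℕ
    𝟙 p = indicator ∘ lookup p
    κ : Fin (n G) → ℕ
    κ u = 𝟙 D u ∸ 𝟙 D′ u
    row : ∀ u → ∑[ v < n H ] indicator (inKernelProduct u v) ≡ 𝟙 D′ u * ∣ E ∣ + κ u * ∣ E′ ∣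
    row u = begin
      ∑[ v < n H ] indicator (inKernelProduct u v)
        ≡⟨ sum-cong-≗ (indicator-inKernelProduct u) ⟩
      ∑[ v < n H ] (𝟙 D′ u * 𝟙 E v + κ u * 𝟙 E′ v)
        ≡⟨ ∑-linearˡ (𝟙 D′ u) (κ u) (𝟙 E) (𝟙 E′) ⟩
      𝟙 D′ u * sum (𝟙 E) + κ u * sum (𝟙 E′)
        ≡⟨ cong₂ (λ e e′ → 𝟙 D′ u * e + κ u * e′) (∣p∣≡∑indicator E) (∣p∣≡∑indicator E′) ⟨
      𝟙 D′ u * ∣ E ∣ + κ u * ∣ E′ ∣
        ∎
    ∑κ : sum κ ≡ ∣ D ∣ ∸ ∣ D′ ∣
    ∑κ = ≡.trans (∑-distrib-∸ (𝟙 D) (𝟙 D′) (λ u → indicator-mono (lookup-⊆ D′⊆D)))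
      (cong₂ _∸_ (≡.sym (∣p∣≡∑indicator D)) (≡.sym (∣p∣≡∑indicator D′)))

  dominated-from-D′×E : Dominating G D′ → TotalDominating H E →
    ∀ w → fstV G H w ∉ D′ → ∃[ y ] (y ∈ kernelProduct × Adj (G ×ᵍ H) y w)
  dominated-from-D′×E D′-dom E-total w u∉D′
    with D′-dom (fstV G H w) | E-total (sndV G H w)
  ... | inj₁ u∈D′             | _ = contradiction u∈D′ u∉D′
  ... | inj₂ (x , x∈D′ , x~u) | z , z∈E , v~z =
    combine x z , combine-∈-kernelProduct (inKernelProduct-D′×E x∈D′ z∈E)
                , combine-adj G H x~u (sym H _ z v~z)

  dominated-from-D×E′ : TotalDominating G D → Dominating H E′ → E′ ⊆ E →
    ∀ w → sndV G H w ∉ E′ → ∃[ y ] (y ∈ kernelProduct × Adj (G ×ᵍ H) y w)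
  dominated-from-D×E′ D-total E′-dom E′⊆E w v∉E′
    with E′-dom (sndV G H w) | D-total (fstV G H w)
  ... | inj₁ v∈E′             | _ = contradiction v∈E′ v∉E′
  ... | inj₂ (z , z∈E′ , z~v) | x , x∈D , u~x =
    combine x z , combine-∈-kernelProduct (inKernelProduct-D×E′ x∈D z∈E′ (E′⊆E z∈E′))
                , combine-adj G H (sym G _ x u~x) z~v

  kernelProduct-dominating : TotalDominating G D → Dominating G D′ →
    TotalDominating H E → Dominating H E′ → E′ ⊆ E →
    Dominating (G ×ᵍ H) kernelProduct
  kernelProduct-dominating D-total D′-dom E-total E′-dom E′⊆E w
    with fstV G H w ∈? D′ | sndV G H w ∈? E′
  ... | no u∉D′  | _        = inj₂ (dominated-from-D′×E D′-dom E-total w u∉D′)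
  ... | yes u∈D′ | yes v∈E′ = inj₁ (∈-kernelProduct (inKernelProduct-D′×E u∈D′ (E′⊆E v∈E′)))
  ... | yes _    | no v∉E′  = inj₂ (dominated-from-D×E′ D-total E′-dom E′⊆E w v∉E′)

IsTotalDomNumber-unique : ∀ G {s t} → IsTotalDomNumber G s → IsTotalDomNumber G t → s ≡ t
IsTotalDomNumber-unique G ((A , A-total , ∣A∣≡s) , s-min) ((B , B-total , ∣B∣≡t) , t-min) =
  ≤-antisym (≤-trans (s-min B B-total) (≤-reflexive ∣B∣≡t))
            (≤-trans (t-min A A-total) (≤-reflexive ∣A∣≡s))

record Kernel (G : Graph) (t k : ℕ) : Set where
  field
    D D′          : Subset (n G)
    D-total       : TotalDominating G D
    D′-dominating : Dominating G D′
    D′⊆D          : D′ ⊆ D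
    ∣D∣≡t         : ∣ D ∣ ≡ t
    ∣D′∣+k≡∣D∣    : ∣ D′ ∣ + k ≡ ∣ D ∣

  ∣D∣∸∣D′∣≡k : ∣ D ∣ ∸ ∣ D′ ∣ ≡ k
  ∣D∣∸∣D′∣≡k = ≡.trans (cong (_∸ ∣ D′ ∣) (≡.sym ∣D′∣+k≡∣D∣)) (m+n∸m≡n ∣ D′ ∣ k)

  ∣D′∣+k≡t : ∣ D′ ∣ + k ≡ t
  ∣D′∣+k≡t = ≡.trans ∣D′∣+k≡∣D∣ ∣D∣≡t

kernel : ∀ G {t k} → IsTotalDomNumber G t → IsKernelSize G k → Kernel G t k
kernel G γt (D , D′ , (D-total , γt-D) , (D′⊆D , D′-dominating , _) , k≡∣D∣∸∣D′∣) = record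
  { D             = D
  ; D′            = D′
  ; D-total       = D-total
  ; D′-dominating = D′-dominating
  ; D′⊆D          = D′⊆D
  ; ∣D∣≡t         = IsTotalDomNumber-unique G γt-D γt
  ; ∣D′∣+k≡∣D∣    = ≡.trans (cong (∣ D′ ∣ +_) k≡∣D∣∸∣D′∣) (m+[n∸m]≡n (p⊆q⇒∣p∣≤∣q∣ D′⊆D))
  }

module _ {G H : Graph} {tG kG tH kH : ℕ} (𝒟 : Kernel G tG kG) (ℰ : Kernel H tH kH) where
  private
    module 𝒟 = Kernel 𝒟
    module ℰ = Kernel ℰ

  _⊗_ : Subset (n G * n H)
  _⊗_ = kernelProduct G H 𝒟.D 𝒟.D′ ℰ.D ℰ.D′

  ⊗-dominating : Dominating (G ×ᵍ H) _⊗_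
  ⊗-dominating = kernelProduct-dominating G H 𝒟.D 𝒟.D′ ℰ.D ℰ.D′
    𝒟.D-total 𝒟.D′-dominating ℰ.D-total ℰ.D′-dominating ℰ.D′⊆D

  2*∣⊗∣ : 2 * ∣ _⊗_ ∣ ≡ 2 * tG * tH ∸ 2 * kG * kH
  2*∣⊗∣ = begin
    2 * ∣ _⊗_ ∣
      ≡⟨ cong (2 *_) (∣kernelProduct∣ G H 𝒟.D 𝒟.D′ ℰ.D ℰ.D′ 𝒟.D′⊆D) ⟩
    2 * (∣ 𝒟.D′ ∣ * ∣ ℰ.D ∣ + (∣ 𝒟.D ∣ ∸ ∣ 𝒟.D′ ∣) * ∣ ℰ.D′ ∣)
      ≡⟨ cong₂ (λ e k → 2 * (∣ 𝒟.D′ ∣ * e + k * ∣ ℰ.D′ ∣)) (≡.sym ℰ.∣D′∣+k≡∣D∣) 𝒟.∣D∣∸∣D′∣≡k ⟩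
    2 * (∣ 𝒟.D′ ∣ * (∣ ℰ.D′ ∣ + kH) + kG * ∣ ℰ.D′ ∣)
      ≡⟨ m+n∸n≡m _ (2 * kG * kH) ⟨
    2 * (∣ 𝒟.D′ ∣ * (∣ ℰ.D′ ∣ + kH) + kG * ∣ ℰ.D′ ∣) + 2 * kG * kH ∸ 2 * kG * kH
      ≡⟨ cong (_∸ 2 * kG * kH) (expand ∣ 𝒟.D′ ∣ ∣ ℰ.D′ ∣ kG kH) ⟨
    2 * (∣ 𝒟.D′ ∣ + kG) * (∣ ℰ.D′ ∣ + kH) ∸ 2 * kG * kH
      ≡⟨ cong₂ (λ s t → 2 * s * t ∸ 2 * kG * kH) 𝒟.∣D′∣+k≡t ℰ.∣D′∣+k≡t ⟩
    2 * tG * tH ∸ 2 * kG * kH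
      ∎
    where
    open ≡-Reasoning
    expand : ∀ p q k l → 2 * (p + k) * (q + l) ≡ 2 * (p * (q + l) + k * q) + 2 * k * l
    expand = solve-∀

theorem2p6 : (G H : Graph) → NoIsolated G → NoIsolated H →
    (tG tH kG kH r : ℕ) →
    IsTotalDomNumber G tG → IsTotalDomNumber H tH →
    IsKernelNumber G kG → IsKernelNumber H kH →
    IsRomanDomNumber (G ×ᵍ H) r →
    r ≤ 2 * tG * tH ∸ 2 * kG * kH
theorem2p6 G H _ _ tG tH kG kH r γt-G γt-H (isKernel-G , _) (isKernel-H , _) (_ , γR-minimal) =
  begin
    r                          ≤⟨ γR-minimal (twoOn S) S-roman ⟩
    weight (G ×ᵍ H) (twoOn S)  ≡⟨ weight-twoOn (G ×ᵍ H) S ⟩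
    2 * ∣ S ∣                   ≡⟨ 2*∣⊗∣ 𝒟 ℰ ⟩
    2 * tG * tH ∸ 2 * kG * kH   ∎
  where
  open ≤-Reasoning
  𝒟 : Kernel G tG kG
  𝒟 = kernel G γt-G isKernel-G
  ℰ : Kernel H tH kH
  ℰ = kernel H γt-H isKernel-H
  S : Subset (n G * n H)
  S = 𝒟 ⊗ ℰ
  S-roman : RomanDominating (G ×ᵍ H) (twoOn S)
  S-roman = dominating⇒romanDominating (G ×ᵍ H) S (⊗-dominating 𝒟 ℰ)
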